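{- For integers $m\ge 1$ and arbitrary integers $a,b$, let $P_m(a,b)$ denote the number of pinned bitstrings of length $m$ containing exactly $a$ zeros and having a longest run of zeros of length exactly $b$ (so $P_m(a,b)=0$ when no such string exists). Then $P_n(0,0)=0$ and $P_n(n,n)=1$ for every $n\ge1$, and for all integers $n,x,y$ with $1\le y\le x\le n-2$, \[ P_n(x,y)=\sum_{i=0}^{y-1}P_{n-i-1}(x-i,y)+\sum_{j=0}^{y}P_{n-y-1}(x-y,j). \]
   Context: A bitstring is a finite sequence of symbols from $\{0,1\}$. A bitstring is called pinned if its first bit is $0$ and its last bit is $0$. A run of zeros is a maximal block of consecutive $0$s; the longest run of zeros of a string is the maximum length of such a block. -}

module Defs where

open import Data.Bool using (Bool; true; false; _∧_)
open import Data.Nat using (ℕ; zero; suc; _⊔_; _≡ᵇ_)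
open import Data.List using (List; []; _∷_; _++_; map; length; filterᵇ)
open import Data.Maybe using (Maybe; just; nothing)

-- Convention: the bit 0 is represented by false, the bit 1 by true.

bitstrings : ℕ → List (List Bool)
bitstrings zero = [] ∷ []
bitstrings (suc m) = map (false ∷_) (bitstrings m) ++ map (true ∷_) (bitstrings m)

zeros : List Bool → ℕ
zeros [] = 0
zeros (false ∷ xs) = suc (zeros xs)
zeros (true ∷ xs) = zeros xs

-- longest run of zeros; c = length of the current run of zeros
runGo : ℕ → List Bool → ℕ
runGo c [] = c
runGo c (false ∷ xs) = runGo (suc c) xs
runGo c (true ∷ xs) = c ⊔ runGo 0 xs

longestZeroRun : List Bool → ℕ
longestZeroRun = runGo 0

isZeroBit : Maybe Bool → Bool
isZeroBit (just false) = true
isZeroBit _ = false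

lastBit : List Bool → Maybe Bool
lastBit [] = nothing
lastBit (x ∷ []) = just x
lastBit (_ ∷ x ∷ xs) = lastBit (x ∷ xs)

firstBit : List Bool → Maybe Bool
firstBit [] = nothing
firstBit (x ∷ _) = just x

pinned : List Bool → Bool
pinned s = isZeroBit (firstBit s) ∧ isZeroBit (lastBit s)

P : ℕ → ℕ → ℕ → ℕ
P m a b = length (filterᵇ (λ s → pinned s ∧ (zeros s ≡ᵇ a) ∧ (longestZeroRun s ≡ᵇ b)) (bitstrings m))

-- A pinned string containing a 1 is 0ʳ1t with 1 ≤ r ≤ y and t ending in 0: for r < y the tail t
-- must have longest run y, for r = y any longest run j ≤ y is allowed.  Strings ending in 0 are
-- exactly 1ᵏs with s pinned, so their counts Pʳ satisfy Pʳₘ = Pₘ + Pʳₘ₋₁.  Writing Pₙ and Pₙ₋₁ as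
-- such sums of Pʳ-values and subtracting, every Pʳ telescopes to a single P-value; the leftover
-- Pₙ₋₁(x, y) is the term i = 0 of the recurrence.
module Submission where

open import Defs
open import Data.Nat using (ℕ; suc; _+_; _∸_; _≤_)
open import Data.List using (map; upTo)
open import Data.Nat.ListAction using (sum)
open import Data.Product using (_×_)
open import Relation.Binary.PropositionalEquality using (_≡_)

open import Data.Bool using (Bool; true; false; _∧_; T)
open import Data.Bool.Properties using (∧-zeroʳ; ∧-assoc)
open import Data.List using (List; []; _∷_; _++_; length; filterᵇ; applyUpTo)
open import Data.List.Properties using (length-++; filter-++; filter-none; map-upTo)
open import Data.List.Relation.Unary.All as All using (All; []; _∷_)
open import Data.List.Relation.Unary.All.Properties using (++⁺; gmap⁺)
open import Data.Nat using (zero; _<_; _⊔_; _≡ᵇ_; _<ᵇ_; s≤s; z≤n)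
open import Data.Nat.Properties
  using (_≟_; <⇒≢; >⇒≢; m≤m+n; ≤-refl; ≤-trans; n≤1+n; m≤m⊔n; +-identityʳ; +-suc; +-comm; +-commutativeSemigroup; 0∸n≡0)
open import Algebra.Properties.CommutativeSemigroup +-commutativeSemigroup using (interchange; xy∙z≈zx∙y)
open import Data.Product using (_,_)
open import Function using (_∘_)
open import Relation.Nullary using (¬_)
open import Relation.Nullary.Decidable using (dec-true; dec-false; T?)
open import Relation.Binary.PropositionalEquality using (refl; sym; trans; cong; cong₂; subst; module ≡-Reasoning)

𝟙 : Bool → ℕ
𝟙 true = 1
𝟙 false = 0

∑< : ℕ → (ℕ → ℕ) → ℕ
∑< n f = sum (applyUpTo f n)

syntax ∑< n (λ i → e) = ∑[ i < n ] e

∑-cong : ∀ n {f g : ℕ → ℕ} → (∀ i → f i ≡ g i) → ∑< n f ≡ ∑< n g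
∑-cong zero f≗g = refl
∑-cong (suc n) f≗g = cong₂ _+_ (f≗g 0) (∑-cong n (f≗g ∘ suc))

∑-zero : ∀ n {f : ℕ → ℕ} → (∀ i → f i ≡ 0) → ∑< n f ≡ 0
∑-zero zero f≗0 = refl
∑-zero (suc n) f≗0 = cong₂ _+_ (f≗0 0) (∑-zero n (f≗0 ∘ suc))

∑-distrib-+ : ∀ n (f g : ℕ → ℕ) → ∑[ i < n ] (f i + g i) ≡ ∑< n f + ∑< n g
∑-distrib-+ zero f g = refl
∑-distrib-+ (suc n) f g = trans (cong (f 0 + g 0 +_) (∑-distrib-+ n (f ∘ suc) (g ∘ suc)))
                               (interchange (f 0) (g 0) _ _)

𝟙-<ᵇ : ∀ x k → 𝟙 (x <ᵇ k) ≡ ∑[ j < k ] 𝟙 (x ≡ᵇ j)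
𝟙-<ᵇ x zero = refl
𝟙-<ᵇ zero (suc k) = cong suc (sym (∑-zero k (λ _ → refl)))
𝟙-<ᵇ (suc x) (suc k) = 𝟙-<ᵇ x k

private
  variable
    A B : Set

length-filterᵇ-∷ : ∀ (p : A → Bool) x xs →
  length (filterᵇ p (x ∷ xs)) ≡ 𝟙 (p x) + length (filterᵇ p xs)
length-filterᵇ-∷ p x xs with p x
... | true = refl
... | false = refl

length-filterᵇ-++ : ∀ (p : A → Bool) xs ys →
  length (filterᵇ p (xs ++ ys)) ≡ length (filterᵇ p xs) + length (filterᵇ p ys)
length-filterᵇ-++ p xs ys = trans (cong length (filter-++ (T? ∘ p) xs ys)) (length-++ (filterᵇ p xs))

length-filterᵇ-map : ∀ (p : B → Bool) (f : A → B) xs →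
  length (filterᵇ p (map f xs)) ≡ length (filterᵇ (p ∘ f) xs)
length-filterᵇ-map p f [] = refl
length-filterᵇ-map p f (x ∷ xs) =
  trans (length-filterᵇ-∷ p (f x) (map f xs))
        (trans (cong (𝟙 (p (f x)) +_) (length-filterᵇ-map p f xs))
               (sym (length-filterᵇ-∷ (p ∘ f) x xs)))

length-filterᵇ-cong : ∀ {p q : A → Bool} → (∀ x → p x ≡ q x) → ∀ xs →
  length (filterᵇ p xs) ≡ length (filterᵇ q xs)
length-filterᵇ-cong p≗q [] = refl
length-filterᵇ-cong {p = p} {q} p≗q (x ∷ xs) =
  trans (length-filterᵇ-∷ p x xs)
        (trans (cong₂ _+_ (cong 𝟙 (p≗q x)) (length-filterᵇ-cong p≗q xs))
               (sym (length-filterᵇ-∷ q x xs)))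

length-filterᵇ-none : ∀ (p : A → Bool) {xs} → All (λ x → p x ≡ false) xs →
  length (filterᵇ p xs) ≡ 0
length-filterᵇ-none p none = cong length (filter-none (T? ∘ p) (All.map (λ px≡false → subst T px≡false) none))

length-filterᵇ-<ᵇ : ∀ (p : A → Bool) (h : A → ℕ) k xs →
  length (filterᵇ (λ x → p x ∧ (h x <ᵇ k)) xs)
    ≡ ∑[ j < k ] length (filterᵇ (λ x → p x ∧ (h x ≡ᵇ j)) xs)
length-filterᵇ-<ᵇ p h k [] = sym (∑-zero k (λ _ → refl))
length-filterᵇ-<ᵇ p h k (x ∷ xs) = begin
  length (filterᵇ (λ x → p x ∧ (h x <ᵇ k)) (x ∷ xs))
    ≡⟨ length-filterᵇ-∷ _ x xs ⟩
  𝟙 (p x ∧ (h x <ᵇ k)) + length (filterᵇ (λ x → p x ∧ (h x <ᵇ k)) xs)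
    ≡⟨ cong₂ _+_ (indicator (p x)) (length-filterᵇ-<ᵇ p h k xs) ⟩
  ∑[ j < k ] 𝟙 (p x ∧ (h x ≡ᵇ j)) + ∑[ j < k ] length (filterᵇ (λ x → p x ∧ (h x ≡ᵇ j)) xs)
    ≡⟨ sym (∑-distrib-+ k _ _) ⟩
  ∑[ j < k ] (𝟙 (p x ∧ (h x ≡ᵇ j)) + length (filterᵇ (λ x → p x ∧ (h x ≡ᵇ j)) xs))
    ≡⟨ ∑-cong k (λ j → sym (length-filterᵇ-∷ _ x xs)) ⟩
  ∑[ j < k ] length (filterᵇ (λ x → p x ∧ (h x ≡ᵇ j)) (x ∷ xs))
    ∎
  where
  open ≡-Reasoning
  indicator : ∀ b → 𝟙 (b ∧ (h x <ᵇ k)) ≡ ∑[ j < k ] 𝟙 (b ∧ (h x ≡ᵇ j))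
  indicator true = 𝟙-<ᵇ (h x) k
  indicator false = sym (∑-zero k (λ _ → refl))

≡ᵇ-refl : ∀ m → (m ≡ᵇ m) ≡ true
≡ᵇ-refl m = dec-true (m ≟ m) refl

≢⇒≡ᵇ≡false : ∀ {m n} → ¬ m ≡ n → (m ≡ᵇ n) ≡ false
≢⇒≡ᵇ≡false {m} {n} = dec-false (m ≟ n)

c⊔n≡ᵇc : ∀ c n → (c ⊔ n ≡ᵇ c) ≡ (n <ᵇ suc c)
c⊔n≡ᵇc zero zero = refl
c⊔n≡ᵇc zero (suc n) = refl
c⊔n≡ᵇc (suc c) zero = ≡ᵇ-refl c
c⊔n≡ᵇc (suc c) (suc n) = c⊔n≡ᵇc c n

c<b⇒c⊔n≡ᵇb : ∀ {c b} n → c < b → (c ⊔ n ≡ᵇ b) ≡ (n ≡ᵇ b)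
c<b⇒c⊔n≡ᵇb {zero} n c<b = refl
c<b⇒c⊔n≡ᵇb {suc c} zero (s≤s c<b) = ≢⇒≡ᵇ≡false (<⇒≢ c<b)
c<b⇒c⊔n≡ᵇb {suc c} (suc n) (s≤s c<b) = c<b⇒c⊔n≡ᵇb n c<b

zeros≤length : ∀ w → zeros w ≤ length w
zeros≤length [] = z≤n
zeros≤length (false ∷ w) = s≤s (zeros≤length w)
zeros≤length (true ∷ w) = ≤-trans (zeros≤length w) (n≤1+n _)

c≤runGo : ∀ c w → c ≤ runGo c w
c≤runGo c [] = ≤-refl
c≤runGo c (false ∷ w) = ≤-trans (n≤1+n c) (c≤runGo (suc c) w)
c≤runGo c (true ∷ w) = m≤m⊔n c _

count : ℕ → (List Bool → Bool) → ℕ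
count m p = length (filterᵇ p (bitstrings m))

count-suc : ∀ m p → count (suc m) p ≡ count m (p ∘ (false ∷_)) + count m (p ∘ (true ∷_))
count-suc m p = trans (length-filterᵇ-++ p (map (false ∷_) (bitstrings m)) _)
                      (cong₂ _+_ (length-filterᵇ-map p _ (bitstrings m)) (length-filterᵇ-map p _ (bitstrings m)))

count-cong : ∀ m {p q} → (∀ w → p w ≡ q w) → count m p ≡ count m q
count-cong m p≗q = length-filterᵇ-cong p≗q (bitstrings m)

bitstrings-length : ∀ m → All (λ w → length w ≡ m) (bitstrings m)
bitstrings-length zero = refl ∷ []
bitstrings-length (suc m) = ++⁺ (gmap⁺ (cong suc) (bitstrings-length m)) (gmap⁺ (cong suc) (bitstrings-length m))

count-none : ∀ m p → (∀ w → length w ≡ m → p w ≡ false) → count m p ≡ 0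
count-none m p none = length-filterᵇ-none p (All.map (none _) (bitstrings-length m))

count-overfull : ∀ m (p q : List Bool → Bool) → count m (λ w → p w ∧ (zeros w ≡ᵇ suc m) ∧ q w) ≡ 0
count-overfull m p q = count-none m _ λ w |w|≡m →
  trans (cong (λ b → p w ∧ b ∧ q w) (≢⇒≡ᵇ≡false (<⇒≢ (s≤s (subst (zeros w ≤_) |w|≡m (zeros≤length w))))))
        (∧-zeroʳ (p w))

endsInZero : List Bool → Bool
endsInZero w = isZeroBit (lastBit w)

endsInZero-true∷ : ∀ w → endsInZero (true ∷ w) ≡ endsInZero w
endsInZero-true∷ [] = refl
endsInZero-true∷ (b ∷ w) = refl

Pʳ : ℕ → ℕ → ℕ → ℕ
Pʳ m a b = count m (λ w → endsInZero w ∧ (zeros w ≡ᵇ a) ∧ (longestZeroRun w ≡ᵇ b))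

-- For c ≥ 1, counts the pinned strings 0ᶜ ++ w with |w| = m, a zeros in w and longest run b.
P⁰ : ℕ → ℕ → ℕ → ℕ → ℕ
P⁰ c m a b = count m (λ w → endsInZero (false ∷ w) ∧ (zeros w ≡ᵇ a) ∧ (runGo c w ≡ᵇ b))

-- Counts the tails w ending in 0 of the strings 0ᶜ1 ++ w, whose longest run is c ⊔ longestZeroRun w.
Pʳ⊔ : ℕ → ℕ → ℕ → ℕ → ℕ
Pʳ⊔ c m a b = count m (λ w → endsInZero w ∧ (zeros w ≡ᵇ a) ∧ (c ⊔ longestZeroRun w ≡ᵇ b))

P-suc : ∀ m a b → P (suc m) a b ≡ count m (λ w → endsInZero (false ∷ w) ∧ (suc (zeros w) ≡ᵇ a) ∧ (runGo 1 w ≡ᵇ b))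
P-suc m a b = trans (count-suc m _) (trans (cong₂ _+_ refl (count-none m (λ _ → false) (λ _ _ → refl))) (+-identityʳ _))

Pʳ-suc : ∀ m a b → Pʳ m a b ≡ P m a b + Pʳ (m ∸ 1) a b
Pʳ-suc zero a b = refl
Pʳ-suc (suc m) a b = begin
  Pʳ (suc m) a b
    ≡⟨ count-suc m _ ⟩
  _ + count m (λ w → endsInZero (true ∷ w) ∧ (zeros w ≡ᵇ a) ∧ (longestZeroRun w ≡ᵇ b))
    ≡⟨ cong₂ _+_ (sym (P-suc m a b))
                 (count-cong m λ w → cong (_∧ ((zeros w ≡ᵇ a) ∧ (longestZeroRun w ≡ᵇ b))) (endsInZero-true∷ w)) ⟩
  P (suc m) a b + Pʳ m a b
    ∎
  where open ≡-Reasoning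

P⁰-suc : ∀ c m a b → P⁰ c (suc m) a b
  ≡ count m (λ w → endsInZero (false ∷ w) ∧ (suc (zeros w) ≡ᵇ a) ∧ (runGo (suc c) w ≡ᵇ b)) + Pʳ⊔ c m a b
P⁰-suc c m a b = trans (count-suc m _) (cong₂ _+_ refl (count-cong m λ w →
  cong (_∧ ((zeros w ≡ᵇ a) ∧ (c ⊔ longestZeroRun w ≡ᵇ b))) (endsInZero-true∷ w)))

Pʳ⊔-self : ∀ c m a → Pʳ⊔ c m a c ≡ ∑[ j < suc c ] Pʳ m a j
Pʳ⊔-self c m a = begin
  Pʳ⊔ c m a c
    ≡⟨ count-cong m (λ w → trans (cong (λ b → endsInZero w ∧ (zeros w ≡ᵇ a) ∧ b) (c⊔n≡ᵇc c _))
                                 (sym (∧-assoc (endsInZero w) (zeros w ≡ᵇ a) (longestZeroRun w <ᵇ suc c)))) ⟩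
  count m (λ w → (endsInZero w ∧ (zeros w ≡ᵇ a)) ∧ (longestZeroRun w <ᵇ suc c))
    ≡⟨ length-filterᵇ-<ᵇ _ longestZeroRun (suc c) (bitstrings m) ⟩
  ∑[ j < suc c ] count m (λ w → (endsInZero w ∧ (zeros w ≡ᵇ a)) ∧ (longestZeroRun w ≡ᵇ j))
    ≡⟨ ∑-cong (suc c) (λ j → count-cong m (λ w → ∧-assoc (endsInZero w) (zeros w ≡ᵇ a) (longestZeroRun w ≡ᵇ j))) ⟩
  ∑[ j < suc c ] Pʳ m a j
    ∎
  where open ≡-Reasoning

Pʳ⊔-above : ∀ {c b} m a → c < b → Pʳ⊔ c m a b ≡ Pʳ m a b
Pʳ⊔-above m a c<b = count-cong m λ w →
  cong (λ r → endsInZero w ∧ (zeros w ≡ᵇ a) ∧ r) (c<b⇒c⊔n≡ᵇb (longestZeroRun w) c<b)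

-- Reading w bit by bit, a 0 extends the current run c and a 1 closes it; the run closes either
-- below c + d (the rest must reach c + d) or exactly at c + d.
P⁰-firstRun : ∀ d c m a → d ≤ a → a < m →
  P⁰ c m a (c + d) ≡ ∑[ k < d ] Pʳ (m ∸ k ∸ 1) (a ∸ k) (c + d) + ∑[ j < suc (c + d) ] Pʳ (m ∸ d ∸ 1) (a ∸ d) j
P⁰-firstRun zero c (suc m) a z≤n (s≤s _) rewrite +-identityʳ c = begin
  P⁰ c (suc m) a c
    ≡⟨ P⁰-suc c m a c ⟩
  count m (λ w → endsInZero (false ∷ w) ∧ (suc (zeros w) ≡ᵇ a) ∧ (runGo (suc c) w ≡ᵇ c)) + Pʳ⊔ c m a c
    ≡⟨ cong₂ _+_ (count-none m _ (λ w _ → runTooLong w)) (Pʳ⊔-self c m a) ⟩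
  ∑[ j < suc c ] Pʳ m a j
    ∎
  where
  open ≡-Reasoning
  runTooLong : ∀ w → endsInZero (false ∷ w) ∧ (suc (zeros w) ≡ᵇ a) ∧ (runGo (suc c) w ≡ᵇ c) ≡ false
  runTooLong w rewrite ≢⇒≡ᵇ≡false (>⇒≢ (c≤runGo (suc c) w)) =
    trans (cong (endsInZero (false ∷ w) ∧_) (∧-zeroʳ _)) (∧-zeroʳ _)
P⁰-firstRun (suc d) c (suc m) (suc a) (s≤s d≤a) (s≤s a<m) rewrite +-suc c d = begin
  P⁰ c (suc m) (suc a) (suc (c + d))
    ≡⟨ P⁰-suc c m (suc a) (suc (c + d)) ⟩
  P⁰ (suc c) m a (suc c + d) + Pʳ⊔ c m (suc a) (suc (c + d))
    ≡⟨ cong₂ _+_ (P⁰-firstRun d (suc c) m a d≤a a<m) (Pʳ⊔-above m (suc a) (s≤s (m≤m+n c d))) ⟩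
  (shortFirstRun + fullFirstRun) + Pʳ m (suc a) (suc (c + d))
    ≡⟨ xy∙z≈zx∙y shortFirstRun fullFirstRun _ ⟩
  (Pʳ m (suc a) (suc (c + d)) + shortFirstRun) + fullFirstRun
    ∎
  where
  open ≡-Reasoning
  shortFirstRun fullFirstRun : ℕ
  shortFirstRun = ∑[ k < d ] Pʳ (m ∸ k ∸ 1) (a ∸ k) (suc (c + d))
  fullFirstRun = ∑[ j < suc (suc (c + d)) ] Pʳ (m ∸ d ∸ 1) (a ∸ d) j

P⁰-allZeros : ∀ c m → P⁰ c m m (c + m) ≡ 1
P⁰-allZeros c zero rewrite +-identityʳ c | ≡ᵇ-refl c = refl
P⁰-allZeros c (suc m) rewrite +-suc c m = begin
  P⁰ c (suc m) (suc m) (suc (c + m))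
    ≡⟨ P⁰-suc c m (suc m) (suc (c + m)) ⟩
  P⁰ (suc c) m m (suc c + m) + Pʳ⊔ c m (suc m) (suc (c + m))
    ≡⟨ cong₂ _+_ (P⁰-allZeros (suc c) m) (count-overfull m endsInZero _) ⟩
  1
    ∎
  where open ≡-Reasoning

P-firstRun : ∀ m a d → d ≤ a → a < m →
  P (suc m) (suc a) (suc d) ≡ ∑[ k < d ] Pʳ (m ∸ k ∸ 1) (a ∸ k) (suc d) + ∑[ j < suc (suc d) ] Pʳ (m ∸ d ∸ 1) (a ∸ d) j
P-firstRun m a d d≤a a<m = trans (P-suc m (suc a) (suc d)) (P⁰-firstRun d 1 m a d≤a a<m)

[1+m]∸k∸1∸1≡m∸k∸1 : ∀ m k → suc m ∸ k ∸ 1 ∸ 1 ≡ m ∸ k ∸ 1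
[1+m]∸k∸1∸1≡m∸k∸1 m zero = refl
[1+m]∸k∸1∸1≡m∸k∸1 zero (suc k) rewrite 0∸n≡0 k = refl
[1+m]∸k∸1∸1≡m∸k∸1 (suc m) (suc k) = [1+m]∸k∸1∸1≡m∸k∸1 m k

∑-Pʳ-suc : ∀ n m (u v w : ℕ → ℕ) →
  ∑[ k < n ] Pʳ (suc m ∸ u k ∸ 1) (v k) (w k)
    ≡ ∑[ k < n ] P (suc m ∸ u k ∸ 1) (v k) (w k) + ∑[ k < n ] Pʳ (m ∸ u k ∸ 1) (v k) (w k)
∑-Pʳ-suc n m u v w = trans (∑-cong n λ k →
  trans (Pʳ-suc (suc m ∸ u k ∸ 1) (v k) (w k))
        (cong (λ l → P (suc m ∸ u k ∸ 1) (v k) (w k) + Pʳ l (v k) (w k)) ([1+m]∸k∸1∸1≡m∸k∸1 m (u k))))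
  (∑-distrib-+ n _ _)

P-recurrence : ∀ n a d → d ≤ a → 3 + a ≤ n →
  P n (suc a) (suc d)
    ≡ ∑[ i < suc d ] P (n ∸ i ∸ 1) (suc a ∸ i) (suc d) + ∑[ j < suc (suc d) ] P (n ∸ suc d ∸ 1) (suc a ∸ suc d) j
P-recurrence (suc (suc m)) a d d≤a (s≤s (s≤s a<m)) = begin
  P (suc (suc m)) (suc a) (suc d)
    ≡⟨ P-firstRun (suc m) a d d≤a (≤-trans a<m (n≤1+n m)) ⟩
  ∑[ k < d ] Pʳ (suc m ∸ k ∸ 1) (a ∸ k) (suc d) + ∑[ j < suc (suc d) ] Pʳ (suc m ∸ d ∸ 1) (a ∸ d) j
    ≡⟨ cong₂ _+_ (∑-Pʳ-suc d m (λ k → k) (a ∸_) (λ _ → suc d)) (∑-Pʳ-suc (suc (suc d)) m (λ _ → d) (λ _ → a ∸ d) (λ j → j)) ⟩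
  (shortFirstRun + ∑[ k < d ] Pʳ (m ∸ k ∸ 1) (a ∸ k) (suc d)) + (fullFirstRun + ∑[ j < suc (suc d) ] Pʳ (m ∸ d ∸ 1) (a ∸ d) j)
    ≡⟨ interchange shortFirstRun _ fullFirstRun _ ⟩
  (shortFirstRun + fullFirstRun) + (∑[ k < d ] Pʳ (m ∸ k ∸ 1) (a ∸ k) (suc d) + ∑[ j < suc (suc d) ] Pʳ (m ∸ d ∸ 1) (a ∸ d) j)
    ≡⟨ cong ((shortFirstRun + fullFirstRun) +_) (sym (P-firstRun m a d d≤a a<m)) ⟩
  (shortFirstRun + fullFirstRun) + P (suc m) (suc a) (suc d)
    ≡⟨ xy∙z≈zx∙y shortFirstRun fullFirstRun _ ⟩
  (P (suc m) (suc a) (suc d) + shortFirstRun) + fullFirstRun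
    ∎
  where
  open ≡-Reasoning
  shortFirstRun fullFirstRun : ℕ
  shortFirstRun = ∑[ k < d ] P (suc m ∸ k ∸ 1) (a ∸ k) (suc d)
  fullFirstRun = ∑[ j < suc (suc d) ] P (suc m ∸ d ∸ 1) (a ∸ d) j

P-noZeros : ∀ m b → P (suc m) 0 b ≡ 0
P-noZeros m b = trans (P-suc m 0 b) (count-none m _ λ w _ → ∧-zeroʳ (endsInZero (false ∷ w)))

P-allZeros : ∀ m → P (suc m) (suc m) (suc m) ≡ 1
P-allZeros m = trans (P-suc m (suc m) (suc m)) (P⁰-allZeros 1 m)

sum-map-upTo : ∀ (f : ℕ → ℕ) n → sum (map f (upTo n)) ≡ ∑< n f
sum-map-upTo f n = cong sum (map-upTo f n)

mainTheorem2 : ((n : ℕ) → 1 ≤ n → P n 0 0 ≡ 0)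
    × ((n : ℕ) → 1 ≤ n → P n n n ≡ 1)
    × ((n x y : ℕ) → 1 ≤ y → y ≤ x → x + 2 ≤ n →
        P n x y ≡ sum (map (λ i → P (n ∸ i ∸ 1) (x ∸ i) y) (upTo y))
                   + sum (map (λ j → P (n ∸ y ∸ 1) (x ∸ y) j) (upTo (suc y))))
mainTheorem2 = (λ { (suc m) _ → P-noZeros m 0 }) , (λ { (suc m) _ → P-allZeros m }) ,
  λ { n (suc a) (suc d) _ (s≤s d≤a) x+2≤n →
      trans (P-recurrence n a d d≤a (subst (_≤ n) (+-comm (suc a) 2) x+2≤n))
            (sym (cong₂ _+_ (sum-map-upTo (λ i → P (n ∸ i ∸ 1) (suc a ∸ i) (suc d)) (suc d))
                            (sum-map-upTo (P (n ∸ suc d ∸ 1) (a ∸ d)) (suc (suc d))))) }
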